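{- Let $p$ be a prime, $q=p^h$, and let $M$ be a multiset of points in $\mathrm{AG}(2,q)$ which has exactly $k \geq 2$ mod-special directions. Then for every direction $(d)$, $d\in\mathbb F_q\cup\{\infty\}$, the projection function satisfies $\deg \mathrm{pr}_{M,d} \leq k-2$.
   Context: Points of $\mathrm{AG}(2,q)$ are the vectors of $\mathbb F_q^2$. A line with slope $d\in\mathbb F_q$ is a line $Y=dX+b$ ($b\in\mathbb F_q$); a line with slope $\infty$ is a line $X+b=0$. The directions are the symbols $(d)$, $d\in\mathbb F_q\cup\{\infty\}$. For a multiset $M$ (points with positive integer multiplicities), the number of points of $M$ on a line counts multiplicities. A direction $(d)$ is mod-equidistributed for $M$ if all lines with slope $d$ contain the same number of points of $M$ modulo $p$; otherwise it is mod-special. The projection function $\mathrm{pr}_{M,d}:\mathbb F_q\to\mathbb F_p$ maps $b$ to the number of points of $M$ on the line $Y=dX+b$ (or $X+b=0$ if $d=\infty$) reduced mod $p$; it is identified with the unique polynomial in $\mathbb F_q[X]$ of degree at most $q-1$ representing this function. -}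

module Defs where

import Data.Nat as ℕ
open import Data.Nat using (ℕ; zero; suc; _%_; _<_; _∸_; _^_; NonZero)
open import Data.Nat.Primality using (Prime)
open import Data.Fin using (Fin; toℕ)
open import Data.List using (List; foldr; map; concatMap; allFin)
open import Data.Maybe using (Maybe; just; nothing)
open import Data.Product using (_×_; _,_; Σ; ∃; ∃-syntax; proj₁; proj₂)
open import Function.Bundles using (_↔_; _⇔_)
open import Function.Definitions using (Injective)
open import Relation.Binary.PropositionalEquality using (_≡_; _≢_)
open import Relation.Nullary using (Dec; yes; no; ¬_)
open import Algebra.Structures using (IsCommutativeRing)

record FiniteField : Set₁ where
  infixl 7 _*_
  infixl 6 _+_
  field
    Carrier : Set
    _+_ _*_ : Carrier → Carrier → Carrier
    -_      : Carrier → Carrier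
    0# 1#   : Carrier
    isCommutativeRing : IsCommutativeRing _≡_ _+_ _*_ -_ 0# 1#
    0≢1     : 0# ≢ 1#
    inverse : ∀ x → x ≢ 0# → ∃[ y ] (x * y ≡ 1#)
    _≟_     : (x y : Carrier) → Dec (x ≡ y)
    size    : ℕ
    enum    : Fin size ↔ Carrier

module AG2 (F : FiniteField) where
  open FiniteField F
  open Function.Bundles.Inverse enum using (to)

  q : ℕ
  q = size

  elems : List Carrier
  elems = map to (allFin q)

  Point : Set
  Point = Carrier × Carrier

  Multiset : Set
  Multiset = Point → ℕ

  -- Directions (d), d ∈ F_q ∪ {∞}; nothing represents ∞.
  Direction : Set
  Direction = Maybe Carrier

  OnLine : Direction → Carrier → Point → Set
  OnLine (just d) b (x , y) = y ≡ d * x + b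
  OnLine nothing  b (x , y) = x + b ≡ 0#

  onLine? : ∀ d b P → Dec (OnLine d b P)
  onLine? (just d) b (x , y) = y ≟ (d * x + b)
  onLine? nothing  b (x , y) = (x + b) ≟ 0#

  sumℕ : List ℕ → ℕ
  sumℕ = foldr ℕ._+_ 0

  count : Multiset → Direction → Carrier → ℕ
  count M d b =
    sumℕ (concatMap (λ x → map (λ y → contrib (x , y)) elems) elems)
    where
    contrib : Point → ℕ
    contrib P with onLine? d b P
    ... | yes _ = M P
    ... | no  _ = 0

  ModEquidistributed : (p : ℕ) .{{_ : NonZero p}} → Multiset → Direction → Set
  ModEquidistributed p M d = ∀ b b' → count M d b % p ≡ count M d b' % p

  ModSpecial : (p : ℕ) .{{_ : NonZero p}} → Multiset → Direction → Set
  ModSpecial p M d = ¬ ModEquidistributed p M d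

  HasExactlyModSpecial : (p : ℕ) .{{_ : NonZero p}} → Multiset → ℕ → Set
  HasExactlyModSpecial p M k =
    Σ (Fin k → Direction) λ f →
      Injective _≡_ _≡_ f × (∀ d → ModSpecial p M d ⇔ (∃[ i ] f i ≡ d))

  -- the image of a natural number in the prime field F_p ⊆ F_q
  -- (n ↦ n·1, which depends only on n mod p when char F_q = p)
  ℕ→F : ℕ → Carrier
  ℕ→F zero    = 0#
  ℕ→F (suc n) = 1# + ℕ→F n

  pr : Multiset → Direction → Carrier → Carrier
  pr M d b = ℕ→F (count M d b)

  Poly : Set
  Poly = Fin q → Carrier

  _^F_ : Carrier → ℕ → Carrier
  x ^F zero  = 1#
  x ^F suc n = x * (x ^F n)

  eval : Poly → Carrier → Carrier
  eval c x = foldr _+_ 0# (map (λ i → c i * (x ^F toℕ i)) (allFin q))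

  Represents : Poly → (Carrier → Carrier) → Set
  Represents c f = ∀ x → eval c x ≡ f x

  DegreeAtMost : Poly → ℕ → Set
  DegreeAtMost c n = ∀ (i : Fin q) → n < toℕ i → c i ≡ 0#

{-# OPTIONS --safe #-}
-- Let c be the coefficient vector of pr = pr_{M,d}. Since Σ_b b^n over F_q is -1 for n = q-1 and
-- 0 for every other n < 2(q-1), for e < q-1 the moment μ_e(d) = Σ_b pr(b) b^e equals -c_{q-1-e};
-- so it is enough that μ_e(d) = 0 for e < q-1 with e + k ≤ q. Counting points on lines,
-- μ_e(d) = Σ_{(x,y)} M(x,y) (y - d x)^e, a polynomial in the slope d of degree ≤ e whose
-- coefficient of d^e is μ_e(∞). An equidistributed direction has constant pr, so its moments
-- vanish. Hence the polynomial has a root at each of the ≥ q - k non-special finite slopes: if (∞)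
-- is not special its leading coefficient μ_e(∞) vanishes and q - k ≥ e roots suffice, and if (∞) is
-- special there are ≥ q - k + 1 > e of them. Either way all the moments vanish. Only the fact that
-- the special directions are among k given ones is used (not their distinctness, nor 2 ≤ k), and
-- q = p^h only through p·1 = 0.
module Submission where

open import Defs

open import Level using (Level; 0ℓ)
open import Data.Nat as ℕ using (ℕ)
open import Relation.Binary.PropositionalEquality using (_≡_)
open import Algebra.Bundles using (CommutativeRing; CommutativeMonoid; RawRing)
open import Data.Product using (_,_; ∃; proj₁; proj₂)

module IntegerCoefficientSolver {c ℓ : Level} (R : CommutativeRing c ℓ) where
  open import Data.Nat as ℕ using (suc)
  open import Data.Integer as ℤ using (ℤ; +_; -[1+_]; _⊖_)
  import Data.Integer.Properties as ℤ
  import Data.Nat.Properties as ℕ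
  open import Data.Maybe using (Maybe; just; nothing)
  open import Relation.Nullary using (yes; no)
  import Relation.Binary.PropositionalEquality as ≡
  open import Algebra.Solver.Ring.AlmostCommutativeRing
    using (fromCommutativeRing; _-Raw-AlmostCommutative⟶_)

  open CommutativeRing R
  open import Algebra.Properties.Ring ring using (-‿involutive; -‿distribˡ-*; -‿distribʳ-*; -0#≈0#)
  open import Algebra.Properties.AbelianGroup +-abelianGroup using (⁻¹-∙-comm)
  open import Algebra.Properties.Semiring.Mult.TCOptimised semiring using (_×_; ×-homo-+; ×1-homo-*; 1+×)
  open import Relation.Binary.Reasoning.Setoid setoid

  -- The optimised `_×_` has `1 × x = x` by definition, so the solver's constants
  -- `con (+ 0)` and `con (+ 1)` evaluate to `0#` and `1#` on the nose.
  ℤ→R : ℤ → Carrier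
  ℤ→R (+ n)    = n × 1#
  ℤ→R -[1+ n ] = - (suc n × 1#)

  ℤ→R-neg : ∀ i → ℤ→R (ℤ.- i) ≈ - ℤ→R i
  ℤ→R-neg (+ 0)      = sym -0#≈0#
  ℤ→R-neg (+ suc n)  = refl
  ℤ→R-neg -[1+ n ]   = sym (-‿involutive _)

  ℤ→R-⊖ : ∀ m n → ℤ→R (m ⊖ n) ≈ m × 1# + - (n × 1#)
  ℤ→R-⊖ 0       0       = sym (-‿inverseʳ 0#)
  ℤ→R-⊖ 0       (suc n) = sym (+-identityˡ _)
  ℤ→R-⊖ (suc m) 0       = sym (trans (+-congˡ -0#≈0#) (+-identityʳ _))
  ℤ→R-⊖ (suc m) (suc n) = begin
    ℤ→R (suc m ⊖ suc n)                ≡⟨ ≡.cong ℤ→R (ℤ.[1+m]⊖[1+n]≡m⊖n m n) ⟩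
    ℤ→R (m ⊖ n)                        ≈⟨ ℤ→R-⊖ m n ⟩
    a + - b                            ≈⟨ +-congʳ (sym (+-identityˡ a)) ⟩
    (0# + a) + - b                     ≈⟨ +-congʳ (+-congʳ (sym (-‿inverseʳ 1#))) ⟩
    ((1# + - 1#) + a) + - b            ≈⟨ +-congʳ (+-assoc 1# (- 1#) a) ⟩
    (1# + (- 1# + a)) + - b            ≈⟨ +-congʳ (+-congˡ (+-comm (- 1#) a)) ⟩
    (1# + (a + - 1#)) + - b            ≈⟨ +-congʳ (sym (+-assoc 1# a (- 1#))) ⟩
    ((1# + a) + - 1#) + - b            ≈⟨ +-assoc (1# + a) (- 1#) (- b) ⟩
    (1# + a) + (- 1# + - b)            ≈⟨ +-congˡ (⁻¹-∙-comm 1# b) ⟩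
    (1# + a) + - (1# + b)              ≈⟨ +-cong (sym (1+× m 1#)) (-‿cong (sym (1+× n 1#))) ⟩
    suc m × 1# + - (suc n × 1#)        ∎
    where a = m × 1#; b = n × 1#

  ℤ→R-+ : ∀ i j → ℤ→R (i ℤ.+ j) ≈ ℤ→R i + ℤ→R j
  ℤ→R-+ (+ m)    (+ n)    = ×-homo-+ 1# m n
  ℤ→R-+ (+ m)    -[1+ n ] = ℤ→R-⊖ m (suc n)
  ℤ→R-+ -[1+ m ] (+ n)    = trans (ℤ→R-⊖ n (suc m)) (+-comm _ _)
  ℤ→R-+ -[1+ m ] -[1+ n ] = begin
    - (suc (suc (m ℕ.+ n)) × 1#)       ≡⟨ ≡.cong (λ k → - (suc k × 1#)) (≡.sym (ℕ.+-suc m n)) ⟩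
    - ((suc m ℕ.+ suc n) × 1#)         ≈⟨ -‿cong (×-homo-+ 1# (suc m) (suc n)) ⟩
    - (suc m × 1# + suc n × 1#)        ≈⟨ sym (⁻¹-∙-comm _ _) ⟩
    - (suc m × 1#) + - (suc n × 1#)    ∎

  ℤ→R-*⁺ : ∀ m j → ℤ→R (+ m ℤ.* j) ≈ ℤ→R (+ m) * ℤ→R j
  ℤ→R-*⁺ m (+ n)    = trans (reflexive (≡.cong ℤ→R (≡.sym (ℤ.pos-* m n)))) (×1-homo-* m n)
  ℤ→R-*⁺ m -[1+ n ] = begin
    ℤ→R (+ m ℤ.* ℤ.- (+ suc n))        ≡⟨ ≡.cong ℤ→R (≡.sym (ℤ.neg-distribʳ-* (+ m) (+ suc n))) ⟩
    ℤ→R (ℤ.- (+ m ℤ.* + suc n))        ≈⟨ ℤ→R-neg (+ m ℤ.* + suc n) ⟩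
    - ℤ→R (+ m ℤ.* + suc n)            ≈⟨ -‿cong (ℤ→R-*⁺ m (+ suc n)) ⟩
    - (m × 1# * suc n × 1#)            ≈⟨ -‿distribʳ-* _ _ ⟩
    m × 1# * - (suc n × 1#)            ∎

  ℤ→R-* : ∀ i j → ℤ→R (i ℤ.* j) ≈ ℤ→R i * ℤ→R j
  ℤ→R-* (+ m)    j = ℤ→R-*⁺ m j
  ℤ→R-* -[1+ m ] j = begin
    ℤ→R (ℤ.- (+ suc m) ℤ.* j)          ≡⟨ ≡.cong ℤ→R (≡.sym (ℤ.neg-distribˡ-* (+ suc m) j)) ⟩
    ℤ→R (ℤ.- (+ suc m ℤ.* j))          ≈⟨ ℤ→R-neg (+ suc m ℤ.* j) ⟩
    - ℤ→R (+ suc m ℤ.* j)              ≈⟨ -‿cong (ℤ→R-*⁺ (suc m) j) ⟩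
    - (suc m × 1# * ℤ→R j)             ≈⟨ -‿distribˡ-* _ _ ⟩
    - (suc m × 1#) * ℤ→R j             ∎

  ℤ-rawRing : RawRing _ _
  ℤ-rawRing = record
    { Carrier = ℤ ; _≈_ = _≡_ ; _+_ = ℤ._+_ ; _*_ = ℤ._*_ ; -_ = ℤ.-_ ; 0# = + 0 ; 1# = + 1 }

  ℤ-homomorphism : ℤ-rawRing -Raw-AlmostCommutative⟶ fromCommutativeRing R
  ℤ-homomorphism = record
    { ⟦_⟧ = ℤ→R ; +-homo = ℤ→R-+ ; *-homo = ℤ→R-* ; -‿homo = ℤ→R-neg
    ; 0-homo = refl ; 1-homo = refl }

  ℤ→R-≟ : ∀ i j → Maybe (ℤ→R i ≈ ℤ→R j)
  ℤ→R-≟ i j with i ℤ.≟ j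
  ... | yes i≡j = just (reflexive (≡.cong ℤ→R i≡j))
  ... | no _    = nothing

  open import Algebra.Solver.Ring ℤ-rawRing (fromCommutativeRing R) ℤ-homomorphism ℤ→R-≟ public

module FiniteSums {c ℓ : Level} (M : CommutativeMonoid c ℓ) where
  open import Data.Nat using (suc)
  open import Data.Fin using (Fin; punchIn)
  open import Data.Fin.Properties using (punchInᵢ≢i)
  open import Data.List using (List; foldr; map; allFin; tabulate; length)
  open import Data.List.Properties using (map-∘; map-tabulate; length-map; length-tabulate)
  open import Data.List.Relation.Unary.Unique.Propositional using (Unique)
  import Data.List.Relation.Unary.Unique.Propositional.Properties as UniqueP
  open import Function.Bundles using (_↔_; Inverse)
  open import Function.Construct.Composition using (_↔-∘_)
  open import Function.Construct.Symmetry using (↔-sym)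
  import Relation.Binary.PropositionalEquality as ≡
  open ≡ using (_≢_)

  open CommutativeMonoid M renaming (_∙_ to _+_; ε to 0#; ∙-congˡ to +-congˡ)
  open import Algebra.Properties.CommutativeMonoid.Sum M public using (sum; sum-replicate-zero)
  open import Algebra.Properties.CommutativeMonoid.Sum M
    using (sum-cong-≋; ∑-distrib-+; ∑-comm; sum-permute; sum-remove; sum-replicate)
  open import Algebra.Properties.Monoid.Mult monoid using (_×_)
  open import Relation.Binary.Reasoning.Setoid setoid

  foldr-tabulate : ∀ {n} (f : Fin n → Carrier) → foldr _+_ 0# (tabulate f) ≈ sum f
  foldr-tabulate {0}     f = refl
  foldr-tabulate {suc n} f = +-congˡ (foldr-tabulate (λ i → f (Fin.suc i)))

  foldr-allFin : ∀ {n} (f : Fin n → Carrier) → foldr _+_ 0# (map f (allFin n)) ≈ sum f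
  foldr-allFin {n} f = trans (reflexive (≡.cong (foldr _+_ 0#) (map-tabulate (λ i → i) f))) (foldr-tabulate f)

  sum-single : ∀ {n} (f : Fin n → Carrier) i → (∀ j → j ≢ i → f j ≈ 0#) → sum f ≈ f i
  sum-single {suc n} f i off = begin
    sum f                                  ≈⟨ sum-remove f ⟩
    f i + sum {n} (λ j → f (punchIn i j))  ≈⟨ +-congˡ (sum-cong-≋ (λ j → off (punchIn i j) (punchInᵢ≢i i j))) ⟩
    f i + sum {n} (λ _ → 0#)               ≈⟨ +-congˡ (sum-replicate-zero n) ⟩
    f i + 0#                               ≈⟨ identityʳ (f i) ⟩
    f i                                    ∎

  module Over {A : Set} {n} (enum : Fin n ↔ A) where
    open Inverse enum using (to; from; strictlyInverseˡ; strictlyInverseʳ)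

    elements : List A
    elements = map to (allFin n)

    ⨁ : (A → Carrier) → Carrier
    ⨁ f = sum (λ i → f (to i))

    ⨁-cong : ∀ {f g : A → Carrier} → (∀ x → f x ≈ g x) → ⨁ f ≈ ⨁ g
    ⨁-cong f≈g = sum-cong-≋ (λ i → f≈g (to i))

    ⨁-distrib : ∀ (f g : A → Carrier) → ⨁ (λ x → f x + g x) ≈ ⨁ f + ⨁ g
    ⨁-distrib f g = ∑-distrib-+ (λ i → f (to i)) (λ i → g (to i))

    ⨁-comm : ∀ (f : A → A → Carrier) → ⨁ (λ x → ⨁ (λ y → f x y)) ≈ ⨁ (λ y → ⨁ (λ x → f x y))
    ⨁-comm f = ∑-comm (λ i j → f (to i) (to j))

    ⨁-const : ∀ a → ⨁ (λ _ → a) ≈ n × a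
    ⨁-const a = sum-replicate n

    ⨁-single : ∀ (f : A → Carrier) x → (∀ y → y ≢ x → f y ≈ 0#) → ⨁ f ≈ f x
    ⨁-single f x off = begin
      ⨁ f                 ≈⟨ sum-single _ (from x) (λ j j≢ → off (to j) (λ to-j≡x → j≢ (to-j≡x⇒ to-j≡x))) ⟩
      f (to (from x))     ≡⟨ ≡.cong f (strictlyInverseˡ x) ⟩
      f x                 ∎
      where
      to-j≡x⇒ : ∀ {j} → to j ≡ x → j ≡ from x
      to-j≡x⇒ {j} e = ≡.trans (≡.sym (strictlyInverseʳ j)) (≡.cong from e)

    ⨁-reindex : ∀ (σ : A ↔ A) (f : A → Carrier) → ⨁ (λ x → f (Inverse.to σ x)) ≈ ⨁ f
    ⨁-reindex σ f = begin
      sum {n} (λ i → f (σ.to (to i)))        ≈⟨ sum-cong-≋ {n} (λ i → reflexive (≡.cong f (≡.sym (strictlyInverseˡ (σ.to (to i)))))) ⟩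
      sum (λ i → f (to (Inverse.to π i)))    ≈⟨ sym (sum-permute (λ i → f (to i)) π) ⟩
      ⨁ f                                     ∎
      where
      module σ = Inverse σ
      π : Fin n ↔ Fin n
      π = ↔-sym enum ↔-∘ (σ ↔-∘ enum)

    elements-unique : Unique elements
    elements-unique = UniqueP.map⁺ to-injective (UniqueP.allFin⁺ n)
      where
      to-injective : ∀ {i j} → to i ≡ to j → i ≡ j
      to-injective {i} {j} e = ≡.trans (≡.sym (strictlyInverseʳ i)) (≡.trans (≡.cong from e) (strictlyInverseʳ j))

    length-elements : length elements ≡ n
    length-elements = ≡.trans (length-map to (allFin n)) (length-tabulate (λ i → i))

    ⨁-foldr : ∀ (f : A → Carrier) → foldr _+_ 0# (map f elements) ≈ ⨁ f
    ⨁-foldr f = trans (reflexive (≡.cong (foldr _+_ 0#) (≡.sym (map-∘ (allFin n))))) (foldr-allFin (λ i → f (to i)))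

module FieldFacts (F : FiniteField) where
  open import Data.Nat as ℕ using (ℕ; zero; suc)
  open import Data.Nat.DivMod using (m≡m%n+[m/n]*n)
  open import Data.Sum using (_⊎_; inj₁; inj₂)
  open import Data.Empty using (⊥-elim)
  open import Relation.Nullary using (yes; no)
  open import Relation.Binary.PropositionalEquality
  open import Function.Bundles using (_↔_; mk↔ₛ′; Inverse)
  open import Function.Base using (_∘′_)

  open FiniteField F public using (Carrier; 0#; 1#; _≟_; 0≢1; enum)
  open AG2 F public using (q; elems; _^F_; ℕ→F; eval)

  commutativeRing : CommutativeRing _ _
  commutativeRing = record { isCommutativeRing = FiniteField.isCommutativeRing F }

  open CommutativeRing commutativeRing public
    hiding (Carrier; 0#; 1#; _≈_; refl; sym; trans; reflexive)
  open IntegerCoefficientSolver commutativeRing public using (solve; Polynomial; _:+_; _:*_; _:-_; :-_; _:=_; con)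
  open import Data.Integer using () renaming (+_ to +ℤ_)
  open import Algebra.Properties.Ring ring public using (-‿involutive; -0#≈0#)
  open import Algebra.Properties.Group +-group public using (identityʳ-unique; inverseˡ-unique)
  open import Algebra.Properties.Semiring.Mult semiring public using (_×_; ×-homo-+; ×1-homo-*; ×-assoc-*)
  open import Algebra.Properties.Semiring.Exp semiring public using (_^_; ^-homo-*)
  open import Algebra.Properties.CommutativeSemiring.Exp commutativeSemiring public using (^-distrib-*)
  open import Algebra.Properties.CommutativeSemiring.Binomial commutativeSemiring public
    using () renaming (theorem to binomial-theorem)
  open import Algebra.Properties.Semiring.Sum semiring public
    using (sum; sum-cong-≋; ∑-comm; sum-init-last; *-distribˡ-sum; *-distribʳ-sum)
  open ≡-Reasoning

  :0 :1 : ∀ {n} → Polynomial n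
  :0 = con (+ℤ 0)
  :1 = con (+ℤ 1)

  module ProdFin = FiniteSums *-commutativeMonoid
  module SumFin = FiniteSums +-commutativeMonoid
  module Sum  = SumFin.Over enum
  module Prod = ProdFin.Over enum

  ∑ ∏ : (Carrier → Carrier) → Carrier
  ∑ = Sum.⨁
  ∏ = Prod.⨁

  ∑-*ˡ : ∀ c (f : Carrier → Carrier) → c * ∑ f ≡ ∑ (λ x → c * f x)
  ∑-*ˡ c f = *-distribˡ-sum {q} c (λ i → f (Inverse.to enum i))

  ∑-*ʳ : ∀ c (f : Carrier → Carrier) → ∑ f * c ≡ ∑ (λ x → f x * c)
  ∑-*ʳ c f = *-distribʳ-sum {q} c (λ i → f (Inverse.to enum i))

  ^F≡^ : ∀ x n → x ^F n ≡ x ^ n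
  ^F≡^ x zero    = refl
  ^F≡^ x (suc n) = cong (x *_) (^F≡^ x n)

  ℕ→F≡×1 : ∀ n → ℕ→F n ≡ n × 1#
  ℕ→F≡×1 zero    = refl
  ℕ→F≡×1 (suc n) = cong (1# +_) (ℕ→F≡×1 n)

  x*y≡0⇒x≡0∨y≡0 : ∀ {x y} → x * y ≡ 0# → x ≡ 0# ⊎ y ≡ 0#
  x*y≡0⇒x≡0∨y≡0 {x} {y} xy≡0 with x ≟ 0#
  ... | yes x≡0 = inj₁ x≡0
  ... | no x≢0 with FiniteField.inverse F x x≢0
  ...   | x⁻¹ , xx⁻¹≡1 = inj₂ (begin
    y                  ≡⟨ sym (*-identityˡ y) ⟩
    1# * y             ≡⟨ cong (_* y) (sym xx⁻¹≡1) ⟩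
    x * x⁻¹ * y        ≡⟨ solve 3 (λ x x⁻¹ y → x :* x⁻¹ :* y := x⁻¹ :* (x :* y)) refl x x⁻¹ y ⟩
    x⁻¹ * (x * y)      ≡⟨ cong (x⁻¹ *_) xy≡0 ⟩
    x⁻¹ * 0#           ≡⟨ zeroʳ x⁻¹ ⟩
    0#                 ∎)

  *-nonzero : ∀ {x y} → x ≢ 0# → y ≢ 0# → x * y ≢ 0#
  *-nonzero x≢0 y≢0 xy≡0 with x*y≡0⇒x≡0∨y≡0 xy≡0
  ... | inj₁ x≡0 = x≢0 x≡0
  ... | inj₂ y≡0 = y≢0 y≡0

  ^-nonzero : ∀ {x} n → x ≢ 0# → x ^ n ≢ 0#
  ^-nonzero zero    x≢0 = 0≢1 ∘′ sym
  ^-nonzero (suc n) x≢0 = *-nonzero x≢0 (^-nonzero n x≢0)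

  x-y≡0⇒x≡y : ∀ {x y} → x - y ≡ 0# → x ≡ y
  x-y≡0⇒x≡y {x} {y} x-y≡0 = begin
    x              ≡⟨ solve 2 (λ x y → x := (x :- y) :+ y) refl x y ⟩
    (x - y) + y    ≡⟨ cong (_+ y) x-y≡0 ⟩
    0# + y         ≡⟨ +-identityˡ y ⟩
    y              ∎

  x^n≡0⇒x≡0 : ∀ {x} n → x ^ n ≡ 0# → x ≡ 0#
  x^n≡0⇒x≡0 {x} n x^n≡0 with x ≟ 0#
  ... | yes x≡0 = x≡0
  ... | no  x≢0 = ⊥-elim (^-nonzero n x≢0 x^n≡0)

  -x≡0⇒x≡0 : ∀ {x} → - x ≡ 0# → x ≡ 0#
  -x≡0⇒x≡0 {x} -x≡0 = trans (sym (-‿involutive x)) (trans (cong -_ -x≡0) -0#≈0#)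

  *-cancelˡ-nonzero : ∀ {a x y} → a ≢ 0# → a * x ≡ a * y → x ≡ y
  *-cancelˡ-nonzero {a} {x} {y} a≢0 ax≡ay with x*y≡0⇒x≡0∨y≡0 a[x-y]≡0
    where
    a[x-y]≡0 : a * (x - y) ≡ 0#
    a[x-y]≡0 = begin
      a * (x - y)        ≡⟨ solve 3 (λ a x y → a :* (x :- y) := a :* x :- a :* y) refl a x y ⟩
      a * x - a * y      ≡⟨ cong (_- a * y) ax≡ay ⟩
      a * y - a * y      ≡⟨ -‿inverseʳ (a * y) ⟩
      0#                 ∎
  ... | inj₁ a≡0   = ⊥-elim (a≢0 a≡0)
  ... | inj₂ x-y≡0 = x-y≡0⇒x≡y x-y≡0

  *-bijection : ∀ {a} → a ≢ 0# → Carrier ↔ Carrier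
  *-bijection {a} a≢0 with FiniteField.inverse F a a≢0
  ... | a⁻¹ , aa⁻¹≡1 = mk↔ₛ′ (a *_) (a⁻¹ *_) (cancel a a⁻¹ aa⁻¹≡1) (cancel a⁻¹ a (trans (*-comm a⁻¹ a) aa⁻¹≡1))
    where
    cancel : ∀ b c → b * c ≡ 1# → ∀ x → b * (c * x) ≡ x
    cancel b c bc≡1 x = trans (sym (*-assoc b c x)) (trans (cong (_* x) bc≡1) (*-identityˡ x))

  +1-bijection : Carrier ↔ Carrier
  +1-bijection = mk↔ₛ′ (_+ 1#) (_- 1#)
    (λ x → solve 1 (λ x → x :- :1 :+ :1 := x) refl x)
    (λ x → solve 1 (λ x → x :+ :1 :- :1 := x) refl x)

  q×1≡0 : q × 1# ≡ 0#
  q×1≡0 = identityʳ-unique (∑ (λ x → x)) (q × 1#) (begin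
    ∑ (λ x → x) + q × 1#              ≡⟨ cong (∑ (λ x → x) +_) (sym (Sum.⨁-const 1#)) ⟩
    ∑ (λ x → x) + ∑ (λ _ → 1#)        ≡⟨ sym (Sum.⨁-distrib (λ x → x) (λ _ → 1#)) ⟩
    ∑ (λ x → x + 1#)                  ≡⟨ Sum.⨁-reindex +1-bijection (λ x → x) ⟩
    ∑ (λ x → x)                       ∎)

  ^×1 : ∀ m h → (m ℕ.^ h) × 1# ≡ (m × 1#) ^ h
  ^×1 m zero    = +-identityʳ 1#
  ^×1 m (suc h) = trans (×1-homo-* m (m ℕ.^ h)) (cong (m × 1# *_) (^×1 m h))

  module Characteristic (p : ℕ) .{{_ : ℕ.NonZero p}} where

    p×1≡0 : ∀ h → q ≡ p ℕ.^ h → p × 1# ≡ 0#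
    p×1≡0 h q≡p^h = x^n≡0⇒x≡0 h (trans (sym (^×1 p h)) (trans (cong (_× 1#) (sym q≡p^h)) q×1≡0))

    ×1-mod : p × 1# ≡ 0# → ∀ n → n × 1# ≡ (n ℕ.% p) × 1#
    ×1-mod p×1≡0 n = begin
      n × 1#                                        ≡⟨ cong (_× 1#) (m≡m%n+[m/n]*n n p) ⟩
      (n ℕ.% p ℕ.+ n ℕ./ p ℕ.* p) × 1#              ≡⟨ ×-homo-+ 1# (n ℕ.% p) _ ⟩
      (n ℕ.% p) × 1# + (n ℕ./ p ℕ.* p) × 1#         ≡⟨ cong ((n ℕ.% p) × 1# +_) (×1-homo-* (n ℕ./ p) p) ⟩
      (n ℕ.% p) × 1# + (n ℕ./ p) × 1# * p × 1#      ≡⟨ cong (λ t → (n ℕ.% p) × 1# + (n ℕ./ p) × 1# * t) p×1≡0 ⟩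
      (n ℕ.% p) × 1# + (n ℕ./ p) × 1# * 0#          ≡⟨ solve 2 (λ a b → a :+ b :* :0 := a) refl _ _ ⟩
      (n ℕ.% p) × 1#                                ∎

module ListCounting {A : Set} where
  open import Data.Nat using (suc; _≤_; _+_)
  open import Data.Nat.Properties using (+-suc)
  open import Data.Fin using (Fin; zero; suc)
  open import Data.Fin.Properties using (injective⇒≤)
  open import Data.List using (List; []; _∷_; length; filter; lookup)
  open import Data.List.Relation.Unary.All as All using (All; []; _∷_)
  open import Data.List.Relation.Unary.AllPairs using (_∷_)
  open import Data.List.Relation.Unary.Unique.Propositional using (Unique)
  open import Data.List.Membership.Propositional.Properties using (∈-lookup)
  open import Data.Empty using (⊥-elim)
  open import Relation.Nullary using (yes; no; ¬?)
  open import Relation.Unary using (Pred; Decidable)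
  open import Relation.Binary.PropositionalEquality
  open import Function.Base using (_∘_)

  lookup-injective : ∀ {xs : List A} → Unique xs → ∀ i j → lookup xs i ≡ lookup xs j → i ≡ j
  lookup-injective (_ ∷ _)      zero    zero    _ = refl
  lookup-injective (x∉xs ∷ _)   zero    (suc j) e = ⊥-elim (All.lookup x∉xs (∈-lookup j) e)
  lookup-injective (x∉xs ∷ _)   (suc i) zero    e = ⊥-elim (All.lookup x∉xs (∈-lookup i) (sym e))
  lookup-injective (_ ∷ unique) (suc i) (suc j) e = cong suc (lookup-injective unique i j e)

  Unique-covered⇒length≤ : ∀ {k} (g : Fin k → A) {xs} → Unique xs →
                           All (λ x → ∃ λ i → g i ≡ x) xs → length xs ≤ k
  Unique-covered⇒length≤ g {xs} unique covered = injective⇒≤ index-injective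
    where
    index : Fin (length xs) → Fin _
    index i = proj₁ (All.lookup covered (∈-lookup i))

    index-injective : ∀ {i j} → index i ≡ index j → i ≡ j
    index-injective {i} {j} e = lookup-injective unique i j (begin
      lookup xs i                ≡⟨ sym (proj₂ (All.lookup covered (∈-lookup i))) ⟩
      g (index i)                ≡⟨ cong g e ⟩
      g (index j)                ≡⟨ proj₂ (All.lookup covered (∈-lookup j)) ⟩
      lookup xs j                ∎)
      where open ≡-Reasoning

  length-filter-complement : ∀ {P : Pred A 0ℓ} (P? : Decidable P) xs →
                             length (filter P? xs) + length (filter (¬? ∘ P?) xs) ≡ length xs
  length-filter-complement P? []       = refl
  length-filter-complement P? (x ∷ xs) with P? x
  ... | yes _ = cong suc (length-filter-complement P? xs)
  ... | no  _ = trans (+-suc _ _) (cong suc (length-filter-complement P? xs))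

module Polynomials (F : FiniteField) where
  open FieldFacts F
  open import Data.Nat as ℕ using (zero; suc; _≤_; s≤s)
  open import Data.Fin using (Fin; toℕ; inject₁; fromℕ)
  open import Data.Fin.Properties using (toℕ-inject₁; toℕ-fromℕ)
  open import Data.Vec using (Vec; []; _∷_; tabulate)
  open import Data.List using (List; _∷_; length)
  open import Data.List.Relation.Unary.All as All using (All; []; _∷_)
  open import Data.List.Relation.Unary.AllPairs using (_∷_)
  open import Data.List.Relation.Unary.Unique.Propositional using (Unique)
  open import Data.Sum using (inj₁; inj₂)
  open import Data.Empty using (⊥-elim)
  open import Relation.Binary.PropositionalEquality
  open ≡-Reasoning

  horner : ∀ {n} → Vec Carrier n → Carrier → Carrier
  horner []      x = 0#
  horner (a ∷ p) x = a + x * horner p x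

  evalPoly : ∀ {n} → (Fin n → Carrier) → Carrier → Carrier
  evalPoly c x = sum (λ i → c i * x ^ toℕ i)

  horner-tabulate : ∀ {n} (c : Fin n → Carrier) x → horner (tabulate c) x ≡ evalPoly c x
  horner-tabulate {zero}  c x = refl
  horner-tabulate {suc n} c x = begin
    c₀ + x * horner (tabulate c₊) x              ≡⟨ cong (λ t → c₀ + x * t) (horner-tabulate c₊ x) ⟩
    c₀ + x * evalPoly c₊ x                       ≡⟨ cong₂ _+_ (sym (*-identityʳ c₀)) (*-distribˡ-sum {n} x _) ⟩
    c₀ * 1# + sum (λ i → x * (c₊ i * x ^ toℕ i)) ≡⟨ cong (c₀ * 1# +_) (sum-cong-≋ {n} (λ i → shift (c₊ i) (x ^ toℕ i))) ⟩
    evalPoly c x                                 ∎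
    where
    c₀ = c Fin.zero
    c₊ = λ i → c (Fin.suc i)
    shift : ∀ a y → x * (a * y) ≡ a * (x * y)
    shift = solve 3 (λ x a y → x :* (a :* y) := a :* (x :* y)) refl x

  evalPoly-last : ∀ {n} (c : Fin (suc n) → Carrier) x →
                  evalPoly c x ≡ evalPoly (λ i → c (inject₁ i)) x + c (fromℕ n) * x ^ n
  evalPoly-last {n} c x = begin
    evalPoly c x
      ≡⟨ sum-init-last {n} (λ i → c i * x ^ toℕ i) ⟩
    sum (λ i → c (inject₁ i) * x ^ toℕ (inject₁ i)) + c (fromℕ n) * x ^ toℕ (fromℕ n)
      ≡⟨ cong₂ _+_ (sum-cong-≋ {n} (λ i → cong (λ k → c (inject₁ i) * x ^ k) (toℕ-inject₁ i)))
                   (cong (λ k → c (fromℕ n) * x ^ k) (toℕ-fromℕ n)) ⟩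
    evalPoly (λ i → c (inject₁ i)) x + c (fromℕ n) * x ^ n
      ∎

  evalPoly-*ˡ : ∀ {n} a (c : Fin n → Carrier) x → a * evalPoly c x ≡ evalPoly (λ k → a * c k) x
  evalPoly-*ˡ {n} a c x = trans (*-distribˡ-sum {n} a (λ k → c k * x ^ toℕ k)) (sum-cong-≋ {n} (λ k → sym (*-assoc a (c k) _)))

  ∑-evalPoly : ∀ {n} (c : Carrier → Fin n → Carrier) x → ∑ (λ y → evalPoly (c y) x) ≡ evalPoly (λ k → ∑ (λ y → c y k)) x
  ∑-evalPoly {n} c x = begin
    ∑ (λ y → sum (λ k → c y k * x ^ toℕ k))        ≡⟨ ∑-comm {q} {n} _ ⟩
    sum (λ k → ∑ (λ y → c y k * x ^ toℕ k))        ≡⟨ sum-cong-≋ {n} (λ k → sym (∑-*ʳ (x ^ toℕ k) (λ y → c y k))) ⟩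
    evalPoly (λ k → ∑ (λ y → c y k)) x             ∎

  eval≡evalPoly : ∀ c x → eval c x ≡ evalPoly c x
  eval≡evalPoly c x = trans (SumFin.foldr-allFin (λ i → c i * x ^F toℕ i)) (sum-cong-≋ {q} (λ i → cong (c i *_) (^F≡^ x (toℕ i))))

  quotient : ∀ {n} → Vec Carrier (suc n) → Carrier → Vec Carrier n
  quotient (a ∷ [])    r = []
  quotient (a ∷ b ∷ p) r = horner (b ∷ p) r ∷ quotient (b ∷ p) r

  horner-factor : ∀ {n} (p : Vec Carrier (suc n)) r x → horner p x ≡ (x - r) * horner (quotient p r) x + horner p r
  horner-factor (a ∷ [])    r x = solve 3 (λ a r x → a :+ x :* :0 := (x :- r) :* :0 :+ (a :+ r :* :0)) refl a r x
  horner-factor (a ∷ b ∷ p) r x = begin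
    a + x * horner (b ∷ p) x            ≡⟨ cong (λ t → a + x * t) (horner-factor (b ∷ p) r x) ⟩
    a + x * ((x - r) * Q + e)
      ≡⟨ solve 5 (λ a x r Q e → a :+ x :* ((x :- r) :* Q :+ e) := (x :- r) :* (e :+ x :* Q) :+ (a :+ r :* e)) refl a x r Q e ⟩
    (x - r) * (e + x * Q) + (a + r * e) ∎
    where
    Q = horner (quotient (b ∷ p) r) x
    e = horner (b ∷ p) r

  horner-vanishes : ∀ {n} (p : Vec Carrier n) {rs : List Carrier} → Unique rs → n ≤ length rs →
                    All (λ r → horner p r ≡ 0#) rs → ∀ x → horner p x ≡ 0#
  horner-vanishes []      _ _ _ x = refl
  horner-vanishes (a ∷ p) {r ∷ rs} (r∉rs ∷ unique) (s≤s n≤) (pr≡0 ∷ roots) x = begin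
    horner (a ∷ p) x
      ≡⟨ horner-factor (a ∷ p) r x ⟩
    (x - r) * horner (quotient (a ∷ p) r) x + horner (a ∷ p) r
      ≡⟨ cong₂ (λ s t → (x - r) * s + t) (horner-vanishes (quotient (a ∷ p) r) unique n≤ (quotient-roots r∉rs roots) x) pr≡0 ⟩
    (x - r) * 0# + 0#
      ≡⟨ solve 2 (λ x r → (x :- r) :* :0 :+ :0 := :0) refl x r ⟩
    0#                                              ∎
    where
    quotient-root : ∀ {s} → r ≢ s → horner (a ∷ p) s ≡ 0# → horner (quotient (a ∷ p) r) s ≡ 0#
    quotient-root {s} r≢s ps≡0 with x*y≡0⇒x≡0∨y≡0 (begin
      (s - r) * horner (quotient (a ∷ p) r) s              ≡⟨ sym (+-identityʳ _) ⟩
      (s - r) * horner (quotient (a ∷ p) r) s + 0#         ≡⟨ cong ((s - r) * horner (quotient (a ∷ p) r) s +_) (sym pr≡0) ⟩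
      (s - r) * horner (quotient (a ∷ p) r) s + horner (a ∷ p) r ≡⟨ sym (horner-factor (a ∷ p) r s) ⟩
      horner (a ∷ p) s                                     ≡⟨ ps≡0 ⟩
      0#                                                   ∎)
    ... | inj₁ s-r≡0 = ⊥-elim (r≢s (sym (x-y≡0⇒x≡y s-r≡0)))
    ... | inj₂ q≡0   = q≡0

    quotient-roots : ∀ {ss} → All (r ≢_) ss → All (λ s → horner (a ∷ p) s ≡ 0#) ss →
                     All (λ s → horner (quotient (a ∷ p) r) s ≡ 0#) ss
    quotient-roots []             []             = []
    quotient-roots (r≢s ∷ r≢ss) (ps≡0 ∷ pss≡0) = quotient-root r≢s ps≡0 ∷ quotient-roots r≢ss pss≡0

  evalPoly-vanishes : ∀ {n} (c : Fin n → Carrier) {rs : List Carrier} → Unique rs → n ≤ length rs →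
                      All (λ r → evalPoly c r ≡ 0#) rs → ∀ x → evalPoly c x ≡ 0#
  evalPoly-vanishes c unique n≤ roots x = begin
    evalPoly c x             ≡⟨ sym (horner-tabulate c x) ⟩
    horner (tabulate c) x    ≡⟨ horner-vanishes (tabulate c) unique n≤ (All.map (trans (horner-tabulate c _)) roots) x ⟩
    0#                       ∎

  X^ : ∀ n → Vec Carrier (suc n)
  X^ zero    = 1# ∷ []
  X^ (suc n) = 0# ∷ X^ n

  horner-X^ : ∀ n x → horner (X^ n) x ≡ x ^ n
  horner-X^ zero    x = solve 1 (λ x → :1 :+ x :* :0 := :1) refl x
  horner-X^ (suc n) x = trans (+-identityˡ _) (cong (x *_) (horner-X^ n x))

module PowerSums (F : FiniteField) where
  open FieldFacts F
  open Polynomials F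
  open ListCounting
  open import Data.Nat as ℕ using (ℕ; zero; suc; _≤_; _<_; _∸_; s≤s; z≤n; pred)
  import Data.Nat.Properties as ℕ
  open import Data.Fin as Fin using (Fin; toℕ)
  open import Data.Fin.Properties using (toℕ-injective; toℕ<n)
  open import Data.Vec using (_∷_)
  open import Data.List using (List; filter; length)
  open import Data.List.Relation.Unary.All as All using (All)
  open import Data.List.Relation.Unary.All.Properties using (all-filter)
  import Data.List.Relation.Unary.Unique.Propositional.Properties as UniqueP
  open import Data.Empty using (⊥-elim)
  open import Relation.Nullary using (yes; no; ¬?)
  open import Relation.Binary.Definitions using (tri<; tri≈; tri>)
  open import Relation.Binary.PropositionalEquality
  open import Function.Bundles using (Inverse)
  open import Function.Base using (_∘′_)
  open ≡-Reasoning

  2≤q : 2 ≤ q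
  2≤q with q | q×1≡0 | Inverse.from enum 0#
  ... | suc (suc _) | _     | _ = s≤s (s≤s z≤n)
  ... | suc zero    | 1×1≡0 | _ = ⊥-elim (0≢1 (trans (sym 1×1≡0) (+-identityʳ 1#)))
  ... | zero        | _     | ()

  q-1 : ℕ
  q-1 = pred q

  suc[q-1]≡q : suc q-1 ≡ q
  suc[q-1]≡q = ℕ.suc-pred q {{ℕ.>-nonZero (ℕ.<-trans (s≤s z≤n) 2≤q)}}

  ifZero : Carrier → Carrier → Carrier → Carrier
  ifZero x a b with x ≟ 0#
  ... | yes _ = a
  ... | no  _ = b

  ifZero-0 : ∀ a b → ifZero 0# a b ≡ a
  ifZero-0 a b with 0# ≟ 0#
  ... | yes _   = refl
  ... | no  0≢0 = ⊥-elim (0≢0 refl)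

  ifZero-≢0 : ∀ {x} a b → x ≢ 0# → ifZero x a b ≡ b
  ifZero-≢0 {x} a b x≢0 with x ≟ 0#
  ... | yes x≡0 = ⊥-elim (x≢0 x≡0)
  ... | no  _   = refl

  ∏-nonzero : ∀ {f : Carrier → Carrier} → (∀ x → f x ≢ 0#) → ∏ f ≢ 0#
  ∏-nonzero {f} f≢0 = product-nonzero (λ i → f (Inverse.to enum i)) (λ i → f≢0 _)
    where
    product-nonzero : ∀ {n} (g : Fin n → Carrier) → (∀ i → g i ≢ 0#) → ProdFin.sum g ≢ 0#
    product-nonzero {zero}  g g≢0 = 0≢1 ∘′ sym
    product-nonzero {suc n} g g≢0 = *-nonzero (g≢0 Fin.zero) (product-nonzero (λ i → g (Fin.suc i)) (λ i → g≢0 _))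

  -- With nz x = x (and nz 0 = 1) we have nz (a x) = (1 if x = 0 else a) · nz x, and x ↦ a x
  -- permutes the field; so the product of (1 if x = 0 else a) is 1, and multiplying in the
  -- factor a at x = 0 gives a ^ q = a, without counting the nonzero elements.
  fermat : ∀ {a} → a ≢ 0# → a ^ q-1 ≡ 1#
  fermat {a} a≢0 = *-cancelˡ-nonzero a≢0 (begin
    a * a ^ q-1                                 ≡⟨ cong (a ^_) suc[q-1]≡q ⟩
    a ^ q                                       ≡⟨ sym (Prod.⨁-const a) ⟩
    ∏ (λ _ → a)                                 ≡⟨ Prod.⨁-cong (λ x → sym (scale-split x)) ⟩
    ∏ (λ x → ifZero x 1# a * ifZero x a 1#)     ≡⟨ Prod.⨁-distrib (λ x → ifZero x 1# a) (λ x → ifZero x a 1#) ⟩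
    ∏ (λ x → ifZero x 1# a) * ∏ (λ x → ifZero x a 1#) ≡⟨ cong₂ _*_ ∏scale≡1 ∏at0≡a ⟩
    1# * a                                      ≡⟨ *-comm 1# a ⟩
    a * 1#                                      ∎)
    where
    nz : Carrier → Carrier
    nz x = ifZero x 1# x

    nz≢0 : ∀ x → nz x ≢ 0#
    nz≢0 x with x ≟ 0#
    ... | yes _   = 0≢1 ∘′ sym
    ... | no  x≢0 = x≢0

    nz-scale : ∀ x → nz (a * x) ≡ ifZero x 1# a * nz x
    nz-scale x with x ≟ 0# | (a * x) ≟ 0#
    ... | yes _   | yes _    = sym (*-identityˡ 1#)
    ... | yes x≡0 | no ax≢0  = ⊥-elim (ax≢0 (trans (cong (a *_) x≡0) (zeroʳ a)))
    ... | no  x≢0 | yes ax≡0 = ⊥-elim (*-nonzero a≢0 x≢0 ax≡0)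
    ... | no  _   | no  _    = refl

    scale-split : ∀ x → ifZero x 1# a * ifZero x a 1# ≡ a
    scale-split x with x ≟ 0#
    ... | yes _ = *-identityˡ a
    ... | no  _ = *-identityʳ a

    ∏scale≡1 : ∏ (λ x → ifZero x 1# a) ≡ 1#
    ∏scale≡1 = *-cancelˡ-nonzero (∏-nonzero nz≢0) (begin
      ∏ nz * ∏ (λ x → ifZero x 1# a)           ≡⟨ *-comm _ _ ⟩
      ∏ (λ x → ifZero x 1# a) * ∏ nz           ≡⟨ sym (Prod.⨁-distrib (λ x → ifZero x 1# a) nz) ⟩
      ∏ (λ x → ifZero x 1# a * nz x)           ≡⟨ Prod.⨁-cong (λ x → sym (nz-scale x)) ⟩
      ∏ (λ x → nz (a * x))                     ≡⟨ Prod.⨁-reindex (*-bijection a≢0) nz ⟩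
      ∏ nz                                     ≡⟨ sym (*-identityʳ _) ⟩
      ∏ nz * 1#                                ∎)

    ∏at0≡a : ∏ (λ x → ifZero x a 1#) ≡ a
    ∏at0≡a = trans (Prod.⨁-single _ 0# (λ x x≢0 → ifZero-≢0 a 1# x≢0)) (ifZero-0 a 1#)

  powerSum : ℕ → Carrier
  powerSum m = ∑ (λ x → x ^ m)

  0^n≡0 : ∀ {n} → 1 ≤ n → 0# ^ n ≡ 0#
  0^n≡0 {suc n} _ = zeroˡ _

  1≤q-1 : 1 ≤ q-1
  1≤q-1 = ℕ.pred-mono-≤ 2≤q

  nonzeros : List Carrier
  nonzeros = filter (λ x → ¬? (x ≟ 0#)) elems

  q-1≤length-nonzeros : q-1 ≤ length nonzeros
  q-1≤length-nonzeros = ℕ.+-cancelˡ-≤ 1 q-1 (length nonzeros)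
    (subst (_≤ 1 ℕ.+ length nonzeros) partition (ℕ.+-monoˡ-≤ (length nonzeros) length-zeros≤1))
    where
    zeros = filter (_≟ 0#) elems

    partition : length zeros ℕ.+ length nonzeros ≡ suc q-1
    partition = trans (length-filter-complement (_≟ 0#) elems) (trans Sum.length-elements (sym suc[q-1]≡q))

    length-zeros≤1 : length zeros ≤ 1
    length-zeros≤1 = Unique-covered⇒length≤ (λ (_ : Fin 1) → 0#) (UniqueP.filter⁺ (_≟ 0#) Sum.elements-unique)
                       (All.map (λ x≡0 → Fin.zero , sym x≡0) (all-filter (_≟ 0#) elems))

  roots-of-unity-bound : ∀ {m} → 0 < m → (∀ a → a ≢ 0# → a ^ m ≡ 1#) → q-1 ≤ m
  roots-of-unity-bound {suc n} _ a^m≡1 = ℕ.≮⇒≥ λ m<q-1 → 0≢1 (sym (-x≡0⇒x≡0 (begin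
    - 1#                        ≡⟨ solve 1 (λ x → :- :1 := :- :1 :+ :0 :* x) refl (horner (X^ n) 0#) ⟩
    horner Xᵐ-1 0#              ≡⟨ horner-vanishes Xᵐ-1 nonzeros-unique (ℕ.≤-trans m<q-1 q-1≤length-nonzeros) roots 0# ⟩
    0#                          ∎)))
    where
    Xᵐ-1 = - 1# ∷ X^ n

    root : ∀ {a} → a ≢ 0# → horner Xᵐ-1 a ≡ 0#
    root {a} a≢0 = begin
      - 1# + a * horner (X^ n) a  ≡⟨ cong (λ t → - 1# + a * t) (horner-X^ n a) ⟩
      - 1# + a ^ suc n            ≡⟨ cong (- 1# +_) (a^m≡1 a a≢0) ⟩
      - 1# + 1#                   ≡⟨ -‿inverseˡ 1# ⟩
      0#                          ∎

    nonzeros-unique = UniqueP.filter⁺ (λ x → ¬? (x ≟ 0#)) Sum.elements-unique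
    roots = All.map root (all-filter (λ x → ¬? (x ≟ 0#)) elems)

  powerSum-0 : powerSum 0 ≡ 0#
  powerSum-0 = trans (Sum.⨁-const 1#) q×1≡0

  powerSum-small : ∀ {m} → 0 < m → m < q-1 → powerSum m ≡ 0#
  powerSum-small {m} 0<m m<q-1 with powerSum m ≟ 0#
  ... | yes P≡0 = P≡0
  ... | no  P≢0 = ⊥-elim (ℕ.<⇒≱ m<q-1 (roots-of-unity-bound 0<m a^m≡1))
    where
    a^m≡1 : ∀ a → a ≢ 0# → a ^ m ≡ 1#
    a^m≡1 a a≢0 = *-cancelˡ-nonzero P≢0 (begin
      powerSum m * a ^ m                ≡⟨ *-comm _ _ ⟩
      a ^ m * powerSum m                ≡⟨ ∑-*ˡ (a ^ m) (λ x → x ^ m) ⟩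
      ∑ (λ x → a ^ m * x ^ m)           ≡⟨ Sum.⨁-cong (λ x → sym (^-distrib-* a x m)) ⟩
      ∑ (λ x → (a * x) ^ m)             ≡⟨ Sum.⨁-reindex (*-bijection a≢0) (_^ m) ⟩
      powerSum m                        ≡⟨ sym (*-identityʳ _) ⟩
      powerSum m * 1#                   ∎)

  powerSum-q-1 : powerSum q-1 ≡ - 1#
  powerSum-q-1 = inverseˡ-unique (powerSum q-1) 1# (begin
    powerSum q-1 + 1#                  ≡⟨ cong (powerSum q-1 +_) (sym ∑δ₀≡1) ⟩
    powerSum q-1 + ∑ δ₀                ≡⟨ sym (Sum.⨁-distrib (_^ q-1) δ₀) ⟩
    ∑ (λ x → x ^ q-1 + δ₀ x)           ≡⟨ Sum.⨁-cong pointwise ⟩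
    ∑ (λ _ → 1#)                       ≡⟨ trans (Sum.⨁-const 1#) q×1≡0 ⟩
    0#                                 ∎)
    where
    δ₀ : Carrier → Carrier
    δ₀ x = ifZero x 1# 0#

    ∑δ₀≡1 : ∑ δ₀ ≡ 1#
    ∑δ₀≡1 = trans (Sum.⨁-single δ₀ 0# (λ x x≢0 → ifZero-≢0 1# 0# x≢0)) (ifZero-0 1# 0#)

    pointwise : ∀ x → x ^ q-1 + δ₀ x ≡ 1#
    pointwise x with x ≟ 0#
    ... | yes refl = trans (cong (_+ 1#) (0^n≡0 1≤q-1)) (+-identityˡ 1#)
    ... | no  x≢0  = trans (cong (_+ 0#) (fermat x≢0)) (+-identityʳ 1#)

  powerSum-periodic : ∀ m → powerSum (q-1 ℕ.+ suc m) ≡ powerSum (suc m)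
  powerSum-periodic m = Sum.⨁-cong pointwise
    where
    pointwise : ∀ x → x ^ (q-1 ℕ.+ suc m) ≡ x ^ suc m
    pointwise x with x ≟ 0#
    ... | yes refl = trans (0^n≡0 (ℕ.≤-trans (s≤s z≤n) (ℕ.m≤n+m (suc m) q-1))) (sym (zeroˡ _))
    ... | no  x≢0  = begin
      x ^ (q-1 ℕ.+ suc m)        ≡⟨ ^-homo-* x q-1 (suc m) ⟩
      x ^ q-1 * x ^ suc m        ≡⟨ cong (_* x ^ suc m) (fermat x≢0) ⟩
      1# * x ^ suc m             ≡⟨ *-identityˡ _ ⟩
      x ^ suc m                  ∎

  powerSum-vanishes : ∀ m → m < q-1 ℕ.+ q-1 → m ≢ q-1 → powerSum m ≡ 0#
  powerSum-vanishes m m<2[q-1] m≢q-1 with ℕ.<-cmp m q-1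
  ... | tri≈ _ m≡q-1 _ = ⊥-elim (m≢q-1 m≡q-1)
  ... | tri< m<q-1 _ _ with m
  ...   | zero  = powerSum-0
  ...   | suc _ = powerSum-small (s≤s z≤n) m<q-1
  powerSum-vanishes m m<2[q-1] _ | tri> _ _ q-1<m with ℕ.m≤n⇒∃[o]m+o≡n q-1<m
  ... | r , refl = begin
    powerSum (suc q-1 ℕ.+ r)     ≡⟨ cong powerSum (sym (ℕ.+-suc q-1 r)) ⟩
    powerSum (q-1 ℕ.+ suc r)     ≡⟨ powerSum-periodic r ⟩
    powerSum (suc r)             ≡⟨ powerSum-small (s≤s z≤n) 1+r<q-1 ⟩
    0#                           ∎
    where
    1+r<q-1 : suc r < q-1
    1+r<q-1 = ℕ.+-cancelˡ-< q-1 (suc r) q-1 (subst (ℕ._< q-1 ℕ.+ q-1) (sym (ℕ.+-suc q-1 r)) m<2[q-1])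

  coefficient-by-power-sum : ∀ {n} (c : Fin n → Carrier) (j : Fin n) e → toℕ j ℕ.+ e ≡ q-1 →
                             n ℕ.+ e ≤ q-1 ℕ.+ q-1 → ∑ (λ x → evalPoly c x * x ^ e) ≡ - c j
  coefficient-by-power-sum {n} c j e j+e≡q-1 n+e≤ = begin
    ∑ (λ x → evalPoly c x * x ^ e)                      ≡⟨ Sum.⨁-cong (λ x → *-distribʳ-sum {n} (x ^ e) (λ i → c i * x ^ toℕ i)) ⟩
    ∑ (λ x → sum (λ i → c i * x ^ toℕ i * x ^ e))       ≡⟨ ∑-comm {q} {n} _ ⟩
    sum (λ i → ∑ (λ x → c i * x ^ toℕ i * x ^ e))       ≡⟨ sum-cong-≋ {n} term ⟩
    sum (λ i → c i * powerSum (toℕ i ℕ.+ e))            ≡⟨ SumFin.sum-single _ j off-diagonal ⟩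
    c j * powerSum (toℕ j ℕ.+ e)                        ≡⟨ cong (λ m → c j * powerSum m) j+e≡q-1 ⟩
    c j * powerSum q-1                                  ≡⟨ cong (c j *_) powerSum-q-1 ⟩
    c j * - 1#                                          ≡⟨ solve 1 (λ c → c :* :- :1 := :- c) refl (c j) ⟩
    - c j                                               ∎
    where
    term : ∀ i → ∑ (λ x → c i * x ^ toℕ i * x ^ e) ≡ c i * powerSum (toℕ i ℕ.+ e)
    term i = begin
      ∑ (λ x → c i * x ^ toℕ i * x ^ e)        ≡⟨ Sum.⨁-cong (λ x → trans (*-assoc _ _ _) (cong (c i *_) (sym (^-homo-* x (toℕ i) e)))) ⟩
      ∑ (λ x → c i * x ^ (toℕ i ℕ.+ e))        ≡⟨ sym (∑-*ˡ (c i) (_^ (toℕ i ℕ.+ e))) ⟩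
      c i * powerSum (toℕ i ℕ.+ e)             ∎

    off-diagonal : ∀ i → i ≢ j → c i * powerSum (toℕ i ℕ.+ e) ≡ 0#
    off-diagonal i i≢j = trans (cong (c i *_) (powerSum-vanishes _ i+e< i+e≢q-1)) (zeroʳ (c i))
      where
      i+e< : toℕ i ℕ.+ e < q-1 ℕ.+ q-1
      i+e< = ℕ.≤-trans (ℕ.+-monoˡ-< e (toℕ<n i)) n+e≤
      i+e≢q-1 : toℕ i ℕ.+ e ≢ q-1
      i+e≢q-1 i+e≡q-1 = i≢j (toℕ-injective (ℕ.+-cancelʳ-≡ e (toℕ i) (toℕ j) (trans i+e≡q-1 (sym j+e≡q-1))))

  vanishing-polynomial-coefficients : ∀ {n} (c : Fin n → Carrier) → n ≤ q-1 →
                                      (∀ x → evalPoly c x ≡ 0#) → ∀ j → c j ≡ 0#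
  vanishing-polynomial-coefficients {n} c n≤q-1 c≡0 j = -x≡0⇒x≡0 (begin
    - c j                                       ≡⟨ sym (coefficient-by-power-sum c j e j+e≡q-1 (ℕ.+-mono-≤ n≤q-1 (ℕ.m∸n≤m q-1 (toℕ j)))) ⟩
    ∑ (λ x → evalPoly c x * x ^ e)              ≡⟨ Sum.⨁-cong (λ x → trans (cong (_* x ^ e) (c≡0 x)) (zeroˡ _)) ⟩
    ∑ (λ _ → 0#)                                ≡⟨ SumFin.sum-replicate-zero q ⟩
    0#                                          ∎)
    where
    e = q-1 ∸ toℕ j
    j+e≡q-1 : toℕ j ℕ.+ e ≡ q-1
    j+e≡q-1 = ℕ.m+[n∸m]≡n (ℕ.≤-trans (ℕ.<⇒≤ (toℕ<n j)) n≤q-1)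

module Moments (F : FiniteField) (M : AG2.Multiset F) where
  open FieldFacts F
  open Polynomials F
  open AG2 F using (Direction; onLine?; count; pr; sumℕ)
  open import Data.Nat as ℕ using (ℕ; suc; _∸_)
  import Data.Nat.Properties as ℕ
  open import Data.Nat.Combinatorics using (_C_; nCn≡1)
  open import Data.Fin using (Fin; toℕ; fromℕ)
  open import Data.Fin.Properties using (toℕ-fromℕ)
  open import Data.List using ([]; _∷_; _++_; foldr; map; concatMap)
  open import Data.Nat.ListAction.Properties using (sum-++)
  open import Data.Maybe using (just; nothing)
  open import Relation.Nullary using (yes; no)
  open import Data.Empty using (⊥-elim)
  open import Relation.Binary.PropositionalEquality
  open ≡-Reasoning

  ×1-sumℕ-map : ∀ {A : Set} (g : A → ℕ) xs → sumℕ (map g xs) × 1# ≡ foldr _+_ 0# (map (λ x → g x × 1#) xs)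
  ×1-sumℕ-map g []       = refl
  ×1-sumℕ-map g (x ∷ xs) = trans (×-homo-+ 1# (g x) _) (cong (g x × 1# +_) (×1-sumℕ-map g xs))

  ×1-grid : ∀ (G : Carrier → Carrier → ℕ) xs →
            sumℕ (concatMap (λ x → map (G x) elems) xs) × 1# ≡ foldr _+_ 0# (map (λ x → ∑ (λ y → G x y × 1#)) xs)
  ×1-grid G []       = refl
  ×1-grid G (x ∷ xs) = begin
    sumℕ (map (G x) elems ++ concatMap (λ x → map (G x) elems) xs) × 1#
      ≡⟨ cong (_× 1#) (sum-++ (map (G x) elems) _) ⟩
    (sumℕ (map (G x) elems) ℕ.+ sumℕ (concatMap (λ x → map (G x) elems) xs)) × 1#
      ≡⟨ ×-homo-+ 1# (sumℕ (map (G x) elems)) _ ⟩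
    sumℕ (map (G x) elems) × 1# + sumℕ (concatMap (λ x → map (G x) elems) xs) × 1#
      ≡⟨ cong₂ _+_ (trans (×1-sumℕ-map (G x) elems) (Sum.⨁-foldr _)) (×1-grid G xs) ⟩
    ∑ (λ y → G x y × 1#) + foldr _+_ 0# (map (λ x → ∑ (λ y → G x y × 1#)) xs) ∎

  ×1-grid-cong : ∀ (G H : Carrier → Carrier → ℕ) → (∀ x y → G x y ≡ H x y) →
                 sumℕ (concatMap (λ x → map (G x) elems) elems) × 1# ≡ ∑ (λ x → ∑ (λ y → H x y × 1#))
  ×1-grid-cong G H G≡H = trans (×1-grid G elems)
    (trans (Sum.⨁-foldr _) (Sum.⨁-cong (λ x → Sum.⨁-cong (λ y → cong (_× 1#) (G≡H x y)))))

  lineWeight : Direction → Carrier → Carrier → Carrier → ℕ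
  lineWeight d b x y with onLine? d b (x , y)
  ... | yes _ = M (x , y)
  ... | no  _ = 0

  -- The summand of `count` is local to its where-block and cannot be named, so the left-hand
  -- side of `contrib≡lineWeight` is left to unification with its use in `pr≡∑lineWeight`.
  mutual
    pr≡∑lineWeight : ∀ d b → pr M d b ≡ ∑ (λ x → ∑ (λ y → lineWeight d b x y × 1#))
    pr≡∑lineWeight d b = trans (ℕ→F≡×1 (count M d b)) (×1-grid-cong _ (lineWeight d b) (contrib≡lineWeight d b))

    contrib≡lineWeight : ∀ d b x y → _ ≡ lineWeight d b x y
    contrib≡lineWeight d b x y with onLine? d b (x , y)
    ... | yes _ = refl
    ... | no  _ = refl

  parameterThrough : Direction → Carrier → Carrier → Carrier
  parameterThrough (just d) x y = y - d * x
  parameterThrough nothing  x y = - x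

  lineWeight-through : ∀ d x y → lineWeight d (parameterThrough d x y) x y ≡ M (x , y)
  lineWeight-through d x y with onLine? d (parameterThrough d x y) (x , y)
  ... | yes _ = refl
  lineWeight-through (just d) x y | no off = ⊥-elim (off (solve 3 (λ d x y → y := d :* x :+ (y :- d :* x)) refl d x y))
  lineWeight-through nothing  x y | no off = ⊥-elim (off (-‿inverseʳ x))

  lineWeight-elsewhere : ∀ d b x y → b ≢ parameterThrough d x y → lineWeight d b x y ≡ 0
  lineWeight-elsewhere d b x y b≢ with onLine? d b (x , y)
  ... | no _ = refl
  lineWeight-elsewhere (just d) b x y b≢ | yes on = ⊥-elim (b≢ (begin
    b                       ≡⟨ solve 3 (λ d x b → b := (d :* x :+ b) :- d :* x) refl d x b ⟩
    (d * x + b) - d * x     ≡⟨ cong (_- d * x) (sym on) ⟩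
    y - d * x               ∎))
  lineWeight-elsewhere nothing b x y b≢ | yes on = ⊥-elim (b≢ (begin
    b                       ≡⟨ solve 2 (λ x b → b := (x :+ b) :- x) refl x b ⟩
    (x + b) - x             ≡⟨ cong (_- x) on ⟩
    0# - x                  ≡⟨ +-identityˡ (- x) ⟩
    - x                     ∎))

  weight : Carrier → Carrier → Carrier
  weight x y = M (x , y) × 1#

  moment : ℕ → Direction → Carrier
  moment m d = ∑ (λ b → pr M d b * b ^ m)

  moment≡∑weight : ∀ m d → moment m d ≡ ∑ (λ x → ∑ (λ y → weight x y * parameterThrough d x y ^ m))
  moment≡∑weight m d = begin
    ∑ (λ b → pr M d b * b ^ m)                        ≡⟨ Sum.⨁-cong (λ b → cong (_* b ^ m) (pr≡∑lineWeight d b)) ⟩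
    ∑ (λ b → ∑ (λ x → ∑ (λ y → w b x y)) * b ^ m)
      ≡⟨ Sum.⨁-cong (λ b → trans (∑-*ʳ (b ^ m) (λ x → ∑ (w b x))) (Sum.⨁-cong (λ x → ∑-*ʳ (b ^ m) (w b x)))) ⟩
    ∑ (λ b → ∑ (λ x → ∑ (λ y → w b x y * b ^ m)))     ≡⟨ Sum.⨁-comm (λ b x → ∑ (λ y → w b x y * b ^ m)) ⟩
    ∑ (λ x → ∑ (λ b → ∑ (λ y → w b x y * b ^ m)))     ≡⟨ Sum.⨁-cong (λ x → Sum.⨁-comm (λ b y → w b x y * b ^ m)) ⟩
    ∑ (λ x → ∑ (λ y → ∑ (λ b → w b x y * b ^ m)))     ≡⟨ Sum.⨁-cong (λ x → Sum.⨁-cong (λ y → only-through x y)) ⟩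
    ∑ (λ x → ∑ (λ y → weight x y * parameterThrough d x y ^ m)) ∎
    where
    w : Carrier → Carrier → Carrier → Carrier
    w b x y = lineWeight d b x y × 1#

    only-through : ∀ x y → ∑ (λ b → w b x y * b ^ m) ≡ weight x y * parameterThrough d x y ^ m
    only-through x y = trans
      (Sum.⨁-single (λ b → w b x y * b ^ m) (parameterThrough d x y)
        (λ b b≢ → trans (cong (λ n → n × 1# * b ^ m) (lineWeight-elsewhere d b x y b≢)) (zeroˡ _)))
      (cong (λ n → n × 1# * parameterThrough d x y ^ m) (lineWeight-through d x y))

  slopeCoefficient : ∀ m → Carrier → Carrier → Fin (suc m) → Carrier
  slopeCoefficient m x y k = (m C toℕ k) × ((- x) ^ toℕ k * y ^ (m ∸ toℕ k))

  parameterThrough-power : ∀ m x y d → parameterThrough (just d) x y ^ m ≡ evalPoly (slopeCoefficient m x y) d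
  parameterThrough-power m x y d = begin
    (y - d * x) ^ m                                               ≡⟨ cong (_^ m) (solve 3 (λ x y d → y :- d :* x := :- x :* d :+ y) refl x y d) ⟩
    (- x * d + y) ^ m                                             ≡⟨ binomial-theorem m (- x * d) y ⟩
    sum {suc m} (λ k → (m C toℕ k) × ((- x * d) ^ toℕ k * y ^ (m ∸ toℕ k))) ≡⟨ sum-cong-≋ {suc m} term ⟩
    evalPoly (slopeCoefficient m x y) d                           ∎
    where
    term : ∀ k → (m C toℕ k) × ((- x * d) ^ toℕ k * y ^ (m ∸ toℕ k)) ≡ slopeCoefficient m x y k * d ^ toℕ k
    term k = begin
      (m C toℕ k) × ((- x * d) ^ toℕ k * y ^ (m ∸ toℕ k))        ≡⟨ cong (λ t → (m C toℕ k) × (t * y ^ (m ∸ toℕ k))) (^-distrib-* (- x) d (toℕ k)) ⟩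
      (m C toℕ k) × ((- x) ^ toℕ k * d ^ toℕ k * y ^ (m ∸ toℕ k)) ≡⟨ cong ((m C toℕ k) ×_) (solve 3 (λ a b c → a :* b :* c := a :* c :* b) refl _ _ _) ⟩
      (m C toℕ k) × ((- x) ^ toℕ k * y ^ (m ∸ toℕ k) * d ^ toℕ k) ≡⟨ sym (×-assoc-* (m C toℕ k) _ _) ⟩
      slopeCoefficient m x y k * d ^ toℕ k                        ∎

  slopeCoefficient-top : ∀ m x y → slopeCoefficient m x y (fromℕ m) ≡ (- x) ^ m
  slopeCoefficient-top m x y = begin
    (m C toℕ (fromℕ m)) × ((- x) ^ toℕ (fromℕ m) * y ^ (m ∸ toℕ (fromℕ m)))
      ≡⟨ cong (λ k → (m C k) × ((- x) ^ k * y ^ (m ∸ k))) (toℕ-fromℕ m) ⟩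
    (m C m) × ((- x) ^ m * y ^ (m ∸ m))
      ≡⟨ cong₂ (λ c e → c × ((- x) ^ m * y ^ e)) (nCn≡1 m) (ℕ.n∸n≡0 m) ⟩
    1 × ((- x) ^ m * 1#)
      ≡⟨ trans (+-identityʳ _) (*-identityʳ _) ⟩
    (- x) ^ m                                                            ∎

  momentCoefficient : ∀ m → Fin (suc m) → Carrier
  momentCoefficient m k = ∑ (λ x → ∑ (λ y → weight x y * slopeCoefficient m x y k))

  moment-just : ∀ m d → moment m (just d) ≡ evalPoly (momentCoefficient m) d
  moment-just m d = begin
    moment m (just d)                                        ≡⟨ moment≡∑weight m (just d) ⟩
    ∑ (λ x → ∑ (λ y → weight x y * parameterThrough (just d) x y ^ m))
      ≡⟨ Sum.⨁-cong (λ x → Sum.⨁-cong (λ y → expand x y)) ⟩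
    ∑ (λ x → ∑ (λ y → evalPoly (term x y) d))                ≡⟨ Sum.⨁-cong (λ x → ∑-evalPoly (term x) d) ⟩
    ∑ (λ x → evalPoly (λ k → ∑ (λ y → term x y k)) d)        ≡⟨ ∑-evalPoly (λ x k → ∑ (λ y → term x y k)) d ⟩
    evalPoly (momentCoefficient m) d                         ∎
    where
    term : Carrier → Carrier → Fin (suc m) → Carrier
    term x y k = weight x y * slopeCoefficient m x y k

    expand : ∀ x y → weight x y * parameterThrough (just d) x y ^ m ≡ evalPoly (term x y) d
    expand x y = trans (cong (weight x y *_) (parameterThrough-power m x y d)) (evalPoly-*ˡ (weight x y) (slopeCoefficient m x y) d)

  momentCoefficient-top : ∀ m → momentCoefficient m (fromℕ m) ≡ moment m nothing
  momentCoefficient-top m = trans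
    (Sum.⨁-cong (λ x → Sum.⨁-cong (λ y → cong (weight x y *_) (slopeCoefficient-top m x y))))
    (sym (moment≡∑weight m nothing))

module SpecialDirections (F : FiniteField) (p h : ℕ) .{{_ : ℕ.NonZero p}} (q≡p^h : FiniteField.size F ≡ p ℕ.^ h)
                         (M : AG2.Multiset F) where
  open FieldFacts F
  open Polynomials F
  open PowerSums F
  open Moments F M
  open Characteristic p
  open ListCounting
  open AG2 F using (Direction; pr; count; ModEquidistributed; ModSpecial; Poly; Represents; DegreeAtMost)
  open import Data.Nat as ℕ using (suc; _≤_; _<_; _∸_; s≤s; z≤n)
  import Data.Nat.Properties as ℕ
  open import Data.Fin using (Fin; toℕ; fromℕ; inject₁)
  import Data.Fin.Properties as Fin
  open import Data.Maybe using (just; nothing)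
  import Data.Maybe.Properties as Maybe
  open import Data.List using (List; map; filter; length)
  open import Data.List.Properties using (length-map)
  open import Data.List.Relation.Unary.All as All using (All; _∷_)
  open import Data.List.Relation.Unary.All.Properties as AllP using (all-filter)
  open import Data.List.Relation.Unary.AllPairs using (_∷_)
  open import Data.List.Relation.Unary.Unique.Propositional using (Unique)
  import Data.List.Relation.Unary.Unique.Propositional.Properties as UniqueP
  open import Data.Empty using (⊥-elim)
  open import Relation.Nullary using (Dec; yes; no; ¬_; ¬?)
  open import Relation.Binary.PropositionalEquality
  open import Algebra.Properties.CommutativeSemigroup ℕ.+-commutativeSemigroup using (x∙yz≈y∙xz)
  open ≡-Reasoning

  moment-equidistributed : ∀ {m} d → m < q-1 → ModEquidistributed p M d → moment m d ≡ 0#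
  moment-equidistributed {m} d m<q-1 equidistributed = begin
    ∑ (λ b → pr M d b * b ^ m)          ≡⟨ Sum.⨁-cong (λ b → cong (_* b ^ m) (pr-constant b)) ⟩
    ∑ (λ b → pr M d 0# * b ^ m)         ≡⟨ sym (∑-*ˡ (pr M d 0#) (_^ m)) ⟩
    pr M d 0# * powerSum m              ≡⟨ cong (pr M d 0# *_) (powerSum-vanishes m (ℕ.≤-trans m<q-1 (ℕ.m≤m+n q-1 q-1)) (ℕ.<⇒≢ m<q-1)) ⟩
    pr M d 0# * 0#                      ≡⟨ zeroʳ _ ⟩
    0#                                  ∎
    where
    pr≡%p : ∀ b → pr M d b ≡ (count M d b ℕ.% p) × 1#
    pr≡%p b = trans (ℕ→F≡×1 (count M d b)) (×1-mod (p×1≡0 h q≡p^h) (count M d b))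

    pr-constant : ∀ b → pr M d b ≡ pr M d 0#
    pr-constant b = trans (pr≡%p b) (trans (cong (_× 1#) (equidistributed b 0#)) (sym (pr≡%p 0#)))

  moment-nonspecial : ∀ {m} d → m < q-1 → ¬ ModSpecial p M d → moment m d ≡ 0#
  moment-nonspecial {m} d m<q-1 nonspecial with moment m d ≟ 0#
  ... | yes moment≡0 = moment≡0
  ... | no  moment≢0 = ⊥-elim (nonspecial (λ equidistributed → moment≢0 (moment-equidistributed d m<q-1 equidistributed)))

  module Covering {k} (f : Fin k → Direction) (covers : ∀ d → ModSpecial p M d → ∃ λ i → f i ≡ d)
                 {m} (m<q-1 : m < q-1) (m+k≤q : m ℕ.+ k ≤ q) where

    Covered : Direction → Set
    Covered d = ∃ λ i → f i ≡ d

    covered? : ∀ d → Dec (Covered d)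
    covered? d = Fin.any? (λ i → Maybe.≡-dec _≟_ (f i) d)

    uncovered⇒moment≡0 : ∀ d → ¬ Covered d → moment m d ≡ 0#
    uncovered⇒moment≡0 d uncovered = moment-nonspecial d m<q-1 (λ special → uncovered (covers d special))

    coveredSlopes uncoveredSlopes : List Carrier
    coveredSlopes   = filter (λ s → covered? (just s)) elems
    uncoveredSlopes = filter (λ s → ¬? (covered? (just s))) elems

    enough-uncovered : ∀ δ → δ ℕ.+ length coveredSlopes ≤ k → δ ℕ.+ m ≤ length uncoveredSlopes
    enough-uncovered δ δ+S≤k = ℕ.+-cancelˡ-≤ S (δ ℕ.+ m) N
      (ℕ.≤-trans (ℕ.≤-reflexive S+[δ+m]≡[δ+S]+m) (ℕ.≤-trans (ℕ.+-monoˡ-≤ m δ+S≤k)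
        (ℕ.≤-trans (ℕ.≤-reflexive (ℕ.+-comm k m)) (ℕ.≤-trans m+k≤q (ℕ.≤-reflexive (sym S+N≡q))))))
      where
      S = length coveredSlopes
      N = length uncoveredSlopes
      S+[δ+m]≡[δ+S]+m : S ℕ.+ (δ ℕ.+ m) ≡ δ ℕ.+ S ℕ.+ m
      S+[δ+m]≡[δ+S]+m = trans (x∙yz≈y∙xz S δ m) (sym (ℕ.+-assoc δ S m))
      S+N≡q : S ℕ.+ N ≡ q
      S+N≡q = trans (length-filter-complement (λ s → covered? (just s)) elems) Sum.length-elements

    finiteCovered-unique : Unique (map just coveredSlopes)
    finiteCovered-unique = UniqueP.map⁺ Maybe.just-injective (UniqueP.filter⁺ (λ s → covered? (just s)) Sum.elements-unique)

    finiteCovered-covered : All Covered (map just coveredSlopes)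
    finiteCovered-covered = AllP.map⁺ (all-filter (λ s → covered? (just s)) elems)

    finiteCovered-length : length (map just coveredSlopes) ≡ length coveredSlopes
    finiteCovered-length = length-map just coveredSlopes

    uncoveredSlopes-unique : Unique uncoveredSlopes
    uncoveredSlopes-unique = UniqueP.filter⁺ (λ s → ¬? (covered? (just s))) Sum.elements-unique

    uncoveredSlopes-roots : All (λ s → evalPoly (momentCoefficient m) s ≡ 0#) uncoveredSlopes
    uncoveredSlopes-roots = All.map (λ {s} uncovered → trans (sym (moment-just m s)) (uncovered⇒moment≡0 (just s) uncovered))
                              (all-filter (λ s → ¬? (covered? (just s))) elems)

    momentPolynomial-vanishes : ∀ s → evalPoly (momentCoefficient m) s ≡ 0#
    momentPolynomial-vanishes s with covered? nothing
    ... | yes ∞-covered = evalPoly-vanishes (momentCoefficient m) uncoveredSlopes-unique (enough-uncovered 1 1+S≤k) uncoveredSlopes-roots s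
      where
      1+S≤k : suc (length coveredSlopes) ≤ k
      1+S≤k = subst (λ n → suc n ≤ k) finiteCovered-length
        (Unique-covered⇒length≤ f (∞∉finite ∷ finiteCovered-unique) (∞-covered ∷ finiteCovered-covered))
        where ∞∉finite = AllP.map⁺ (All.universal (λ _ ()) coveredSlopes)
    ... | no ∞-uncovered = begin
      evalPoly c s                ≡⟨ drop-top s ⟩
      evalPoly lower s            ≡⟨ evalPoly-vanishes lower uncoveredSlopes-unique (enough-uncovered 0 S≤k) lower-roots s ⟩
      0#                          ∎
      where
      c = momentCoefficient m
      lower = λ i → c (inject₁ i)

      top≡0 : c (fromℕ m) ≡ 0#
      top≡0 = trans (momentCoefficient-top m) (uncovered⇒moment≡0 nothing ∞-uncovered)

      drop-top : ∀ r → evalPoly c r ≡ evalPoly lower r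
      drop-top r = begin
        evalPoly c r                              ≡⟨ evalPoly-last c r ⟩
        evalPoly lower r + c (fromℕ m) * r ^ m    ≡⟨ cong (λ t → evalPoly lower r + t * r ^ m) top≡0 ⟩
        evalPoly lower r + 0# * r ^ m             ≡⟨ solve 2 (λ a b → a :+ :0 :* b := a) refl (evalPoly lower r) (r ^ m) ⟩
        evalPoly lower r                          ∎

      lower-roots : All (λ r → evalPoly lower r ≡ 0#) uncoveredSlopes
      lower-roots = All.map (λ {r} r-root → trans (sym (drop-top r)) r-root) uncoveredSlopes-roots

      S≤k : length coveredSlopes ≤ k
      S≤k = subst (_≤ k) finiteCovered-length (Unique-covered⇒length≤ f finiteCovered-unique finiteCovered-covered)

    moment-∞ : moment m nothing ≡ 0#
    moment-∞ with covered? nothing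
    ... | no ∞-uncovered = uncovered⇒moment≡0 nothing ∞-uncovered
    ... | yes _          = trans (sym (momentCoefficient-top m))
                             (vanishing-polynomial-coefficients (momentCoefficient m) m<q-1 momentPolynomial-vanishes (fromℕ m))

    moment-vanishes : ∀ d → moment m d ≡ 0#
    moment-vanishes nothing  = moment-∞
    moment-vanishes (just s) = trans (moment-just m s) (momentPolynomial-vanishes s)

  degree-bound : ∀ {k} (f : Fin k → Direction) → (∀ d → ModSpecial p M d → ∃ λ i → f i ≡ d) →
                 ∀ d (c : Poly) → Represents c (pr M d) → DegreeAtMost c (k ∸ 2)
  degree-bound {k} f covers d c represents i k-2<i = -x≡0⇒x≡0 (begin
    - c i                                  ≡⟨ sym (coefficient-by-power-sum c i e i+e≡q-1 q+e≤2[q-1]) ⟩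
    ∑ (λ x → evalPoly c x * x ^ e)         ≡⟨ Sum.⨁-cong (λ x → cong (_* x ^ e) (trans (sym (eval≡evalPoly c x)) (represents x))) ⟩
    moment e d                             ≡⟨ Covering.moment-vanishes f covers e<q-1 e+k≤q d ⟩
    0#                                     ∎)
    where
    t = toℕ i
    e = q-1 ∸ t

    t≤q-1 : t ≤ q-1
    t≤q-1 = ℕ.≤-pred (subst (t <_) (sym suc[q-1]≡q) (Fin.toℕ<n i))

    i+e≡q-1 : t ℕ.+ e ≡ q-1
    i+e≡q-1 = ℕ.m+[n∸m]≡n t≤q-1

    e<q-1 : e < q-1
    e<q-1 = ℕ.∸-monoʳ-< (ℕ.≤-trans (s≤s z≤n) k-2<i) t≤q-1

    q+e≤2[q-1] : q ℕ.+ e ≤ q-1 ℕ.+ q-1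
    q+e≤2[q-1] = subst (λ n → n ℕ.+ e ≤ q-1 ℕ.+ q-1) suc[q-1]≡q
                   (subst (_≤ q-1 ℕ.+ q-1) (ℕ.+-suc q-1 e) (ℕ.+-monoʳ-≤ q-1 e<q-1))

    e+k≤q : e ℕ.+ k ≤ q
    e+k≤q = ℕ.≤-trans (ℕ.+-monoʳ-≤ e k≤1+t)
              (ℕ.≤-reflexive (trans (ℕ.+-suc e t) (trans (cong suc (trans (ℕ.+-comm e t) i+e≡q-1)) suc[q-1]≡q)))
      where
      k≤1+t : k ≤ suc t
      k≤1+t = ℕ.≤-trans (ℕ.m≤n+m∸n k 2) (s≤s k-2<i)

open import Data.Nat using (ℕ; _≤_; _^_; _∸_; NonZero)
open import Data.Nat.Primality using (Prime)
open import Relation.Binary.PropositionalEquality using (_≡_)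
open import Function.Bundles using (Equivalence)

theorem1p7 : (F : FiniteField) (p h : ℕ) .{{_ : NonZero p}} → Prime p →
    FiniteField.size F ≡ p ^ h →
    (M : AG2.Multiset F) (k : ℕ) → 2 ≤ k → AG2.HasExactlyModSpecial F p M k →
    (d : AG2.Direction F) (c : AG2.Poly F) → AG2.Represents F c (AG2.pr F M d) →
    AG2.DegreeAtMost F c (k ∸ 2)
theorem1p7 F p h _ q≡p^h M k _ (f , _ , special⇔covered) =
  SpecialDirections.degree-bound F p h q≡p^h M f (λ d → Equivalence.to (special⇔covered d))
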